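{- Let $\mathfrak{X}=(\Omega,\mathcal{C})$ be a Jordan configuration with $1_\Omega\in\mathcal{C}$ (one fiber). If $\mathfrak{X}$ is not regular, then there exists a partition $\Omega=\Omega_0\cup\Omega_1$ with $|\Omega_0|=|\Omega_1|$ such that every non-regular $C\in\mathcal{C}$ satisfies $C\subseteq\Omega_i\times\Omega_{1-i}$ for some $i\in\{0,1\}$ and $|C(\omega)|$ is constant for $\omega\in\Omega_i$.
   Context: For $R\subseteq\Omega^2$: $R(\alpha)=\{\beta:(\alpha,\beta)\in R\}$, $R^\top$ the transpose. A relation $R$ is regular if $|R(\alpha)|$ does not depend on $\alpha\in\Omega$; a rainbow is regular if all its classes are regular. A rainbow is a partition $\mathcal{C}$ of $\Omega^2$ such that $1_\Omega=\{(\omega,\omega)\}$ is a union of classes and $C^\top\in\mathcal{C}$ for all $C\in\mathcal{C}$. A Jordan configuration is a rainbow such that for all $C,D\in\mathcal{C}$ and all pairs $(\alpha,\beta),(\alpha',\beta')$ in the same class, $|C(\alpha)\cap D^\top(\beta)|+|D(\alpha)\cap C^\top(\beta)|=|C(\alpha')\cap D^\top(\beta')|+|D(\alpha')\cap C^\top(\beta')|$. -}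

module Defs where

open import Data.Nat using (ℕ; zero; suc; _+_)
open import Data.Bool using (Bool; true; false; if_then_else_; not)
open import Data.Fin using (Fin; zero; suc; _≟_)
open import Data.Product using (Σ; ∃; _×_; _,_)
open import Relation.Nullary.Decidable using (⌊_⌋)
open import Relation.Binary.PropositionalEquality using (_≡_)

count : ∀ {n} → (Fin n → Bool) → ℕ
count {zero}  P = 0
count {suc n} P = (if P zero then 1 else 0) + count (λ x → P (suc x))

-- A partition of Ω² = Fin n × Fin n into k classes, given by the class
-- label of each pair; every label is used (classes are non-empty).
Coloring : ℕ → ℕ → Set
Coloring n k = Fin n → Fin n → Fin k

module _ {n k : ℕ} (c : Coloring n k) where

  Surjective : Set
  Surjective = ∀ (i : Fin k) → Σ (Fin n) λ α → Σ (Fin n) λ β → c α β ≡ i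

  -- 1_Ω is a union of classes
  DiagonalUnion : Set
  DiagonalUnion = ∀ α β γ → c α β ≡ c γ γ → α ≡ β

  -- 1_Ω is a single class (with DiagonalUnion: 1_Ω ∈ 𝒞)
  DiagonalOneClass : Set
  DiagonalOneClass = ∀ α β → c α α ≡ c β β

  TransposeClosed : Set
  TransposeClosed = ∀ α β α' β' → c α β ≡ c α' β' → c β α ≡ c β' α'

  IsRainbow : Set
  IsRainbow = Surjective × DiagonalUnion × TransposeClosed

  valency : Fin k → Fin n → ℕ
  valency i α = count (λ γ → ⌊ c α γ ≟ i ⌋)

  inter : Fin k → Fin k → Fin n → Fin n → ℕ
  inter i j α β = count (λ γ → ⌊ c α γ ≟ i ⌋ Data.Bool.∧ ⌊ c γ β ≟ j ⌋)

  IsJordan : Set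
  IsJordan = IsRainbow ×
    (∀ i j α β α' β' → c α β ≡ c α' β' →
       inter i j α β + inter j i α β ≡ inter i j α' β' + inter j i α' β')

  RegularClass : Fin k → Set
  RegularClass i = ∀ α β → valency i α ≡ valency i β

  IsRegular : Set
  IsRegular = ∀ i → RegularClass i

module Submission where

-- Jordan's identity says that for every weight G on pairs of colours, the symmetrised sum
-- ∑_γ G(c α γ, c γ β) + G(c γ β, c α γ) depends only on the colour of (α, β).  With one
-- diagonal class this makes d_C(α) + dᵀ_C(α) and d_C(α) dᵀ_C(α) constant, where d_C and dᵀ_C
-- are the out- and in-valencies of C, so {d_C(α), dᵀ_C(α)} is the same pair {a, b} for every α.
-- For a non-regular class a ≠ b and, by double counting, every C-edge changes the valency;
-- this forces {a, b} = {0, K}, so C runs from Ω₀ = {α | d_C(α) = K} to its complement.  The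
-- double count ∑ d_C = ∑ dᵀ_C gives |Ω₀| = |Ω₁|, and for a second non-regular class C' the
-- constant mixed product d_C dᵀ_C' + dᵀ_C d_C' = K K' [α ∈ Ω₀ xor α ∈ Ω₀'] aligns the two splits.

open import Defs
open import Data.Bool using (Bool; true; false; not; _∧_; _xor_; T; _≟_)
open import Data.Bool.Properties
  using (not-injective; not-¬; ¬-not; xor-assoc; xor-same; xor-identityʳ; xor-comm)
open import Data.Empty using (⊥-elim)
open import Data.Fin using (Fin; zero; suc) renaming (_≟_ to _≟F_)
open import Data.Fin.Properties using (all?; ¬∀⟶∃¬; nonZeroIndex)
open import Data.Nat using (ℕ; zero; suc; _+_; _*_; _≤_; NonZero; ≢-nonZero)
  renaming (_≟_ to _≟ℕ_)
open import Data.Nat.Properties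
  using ( +-*-semiring; +-assoc; +-comm; +-identityʳ; *-comm; *-identityˡ; *-identityʳ; *-zeroʳ
        ; *-distribˡ-+; +-cancelˡ-≡; +-cancelʳ-≡; *-cancelˡ-≡; *-cancelʳ-≡; ≤-total
        ; m≤n⇒∃[o]m+o≡n; m+n≡0⇒m≡0; m*n≢0)
open import Data.Nat.Tactic.RingSolver using (solve-∀)
open import Data.Product using (Σ; ∃; _×_; _,_; proj₁; proj₂)
open import Data.Sum using (_⊎_; inj₁; inj₂)
open import Function using (_∘_)
open import Relation.Nullary using (¬_; yes; no)
open import Relation.Nullary.Decidable using (⌊_⌋; toWitness; fromWitness)
open import Relation.Binary.PropositionalEquality
open import Algebra.Properties.Semiring.Sum +-*-semiring
  using (sum; sum-syntax; ∑-distrib-+; ∑-comm; *-distribˡ-sum; sum-cong-≗)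

𝟙 : Bool → ℕ
𝟙 true  = 1
𝟙 false = 0

𝟙-∧ : ∀ a b → 𝟙 (a ∧ b) ≡ 𝟙 a * 𝟙 b
𝟙-∧ true  b = sym (+-identityʳ (𝟙 b))
𝟙-∧ false b = refl

⌊suc≟suc⌋ : ∀ {k} (x y : Fin k) → ⌊ suc x ≟F suc y ⌋ ≡ ⌊ x ≟F y ⌋
⌊suc≟suc⌋ x y with x ≟F y
... | yes _ = refl
... | no  _ = refl

count≡∑𝟙 : ∀ {m} (P : Fin m → Bool) → count P ≡ ∑[ x < m ] 𝟙 (P x)
count≡∑𝟙 {zero}  P = refl
count≡∑𝟙 {suc m} P with P zero
... | true  = cong suc (count≡∑𝟙 (P ∘ suc))
... | false = count≡∑𝟙 (P ∘ suc)

count-witness : ∀ {m} (P : Fin m → Bool) → count P ≢ 0 → ∃ λ x → T (P x)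
count-witness {zero}  P count≢0 = ⊥-elim (count≢0 refl)
count-witness {suc m} P count≢0 with P zero in eq
... | true  = zero , subst T (sym eq) _
... | false = let x , px = count-witness (P ∘ suc) count≢0 in suc x , px

∑-const : ∀ m a → ∑[ _ < m ] a ≡ m * a
∑-const zero    a = refl
∑-const (suc m) a = cong (a +_) (∑-const m a)

∑-𝟙≟ : ∀ {k} (x : Fin k) (h : Fin k → ℕ) → ∑[ i < k ] (𝟙 ⌊ x ≟F i ⌋ * h i) ≡ h x
∑-𝟙≟ {suc k} zero    h =
  trans (cong₂ _+_ (+-identityʳ (h zero)) (trans (∑-const k 0) (*-zeroʳ k))) (+-identityʳ (h zero))
∑-𝟙≟ {suc k} (suc x) h =
  trans (sum-cong-≗ (λ i → cong (λ b → 𝟙 b * h (suc i)) (⌊suc≟suc⌋ x i))) (∑-𝟙≟ x (h ∘ suc))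

count-positive : ∀ {m} (P : Fin m → Bool) x → T (P x) → count P ≢ 0
count-positive P zero    Px with P zero
... | true  = λ ()
count-positive P (suc x) Px with P zero
... | true  = λ ()
... | false = count-positive (P ∘ suc) x Px

count-cong : ∀ {m} {P Q : Fin m → Bool} → (∀ x → P x ≡ Q x) → count P ≡ count Q
count-cong {P = P} {Q} P≡Q = trans (count≡∑𝟙 P) (trans (sum-cong-≗ (cong 𝟙 ∘ P≡Q)) (sym (count≡∑𝟙 Q)))

∑∑-𝟙≟ : ∀ {k l} (x : Fin k) (y : Fin l) (H : Fin k → Fin l → ℕ) →
  ∑[ i < k ] ∑[ j < l ] (H i j * 𝟙 (⌊ x ≟F i ⌋ ∧ ⌊ y ≟F j ⌋)) ≡ H x y
∑∑-𝟙≟ {k} {l} x y H = begin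
  ∑[ i < k ] ∑[ j < l ] (H i j * 𝟙 (⌊ x ≟F i ⌋ ∧ ⌊ y ≟F j ⌋))
    ≡⟨ sum-cong-≗ (λ i → sum-cong-≗ (λ j → regroup (H i j) ⌊ x ≟F i ⌋ ⌊ y ≟F j ⌋)) ⟩
  ∑[ i < k ] ∑[ j < l ] (𝟙 ⌊ x ≟F i ⌋ * (𝟙 ⌊ y ≟F j ⌋ * H i j))
    ≡⟨ sum-cong-≗ (λ i → sym (*-distribˡ-sum (𝟙 ⌊ x ≟F i ⌋) (λ j → 𝟙 ⌊ y ≟F j ⌋ * H i j))) ⟩
  ∑[ i < k ] (𝟙 ⌊ x ≟F i ⌋ * ∑[ j < l ] (𝟙 ⌊ y ≟F j ⌋ * H i j))
    ≡⟨ sum-cong-≗ (λ i → cong (𝟙 ⌊ x ≟F i ⌋ *_) (∑-𝟙≟ y (H i))) ⟩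
  ∑[ i < k ] (𝟙 ⌊ x ≟F i ⌋ * H i y)
    ≡⟨ ∑-𝟙≟ x (λ i → H i y) ⟩
  H x y ∎
  where
  open ≡-Reasoning
  regroup : ∀ h a b → h * 𝟙 (a ∧ b) ≡ 𝟙 a * (𝟙 b * h)
  regroup h a b = trans (cong (h *_) (𝟙-∧ a b)) (rearrange h (𝟙 a) (𝟙 b))
    where
    rearrange : ∀ h a b → h * (a * b) ≡ a * (b * h)
    rearrange = solve-∀

∑-fibres : ∀ {m k l} (f : Fin m → Fin k) (g : Fin m → Fin l) (H : Fin k → Fin l → ℕ) →
  ∑[ γ < m ] H (f γ) (g γ) ≡
  ∑[ i < k ] ∑[ j < l ] (H i j * count (λ γ → ⌊ f γ ≟F i ⌋ ∧ ⌊ g γ ≟F j ⌋))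
∑-fibres {m} {k} {l} f g H = begin
  ∑[ γ < m ] H (f γ) (g γ)
    ≡⟨ sum-cong-≗ (λ γ → sym (∑∑-𝟙≟ (f γ) (g γ) H)) ⟩
  ∑[ γ < m ] ∑[ i < k ] ∑[ j < l ] (H i j * 𝟙 (fibre i j γ))
    ≡⟨ ∑-comm (λ γ i → ∑[ j < l ] (H i j * 𝟙 (fibre i j γ))) ⟩
  ∑[ i < k ] ∑[ γ < m ] ∑[ j < l ] (H i j * 𝟙 (fibre i j γ))
    ≡⟨ sum-cong-≗ (λ i → ∑-comm (λ γ j → H i j * 𝟙 (fibre i j γ))) ⟩
  ∑[ i < k ] ∑[ j < l ] ∑[ γ < m ] (H i j * 𝟙 (fibre i j γ))
    ≡⟨ sum-cong-≗ (λ i → sum-cong-≗ (λ j → sym (trans (cong (H i j *_) (count≡∑𝟙 (fibre i j))) (*-distribˡ-sum (H i j) (𝟙 ∘ fibre i j))))) ⟩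
  ∑[ i < k ] ∑[ j < l ] (H i j * count (fibre i j)) ∎
  where
  open ≡-Reasoning
  fibre : Fin k → Fin l → Fin m → Bool
  fibre i j γ = ⌊ f γ ≟F i ⌋ ∧ ⌊ g γ ≟F j ⌋

m+m≡n+n⇒m≡n : ∀ {m n} → m + m ≡ n + n → m ≡ n
m+m≡n+n⇒m≡n {m} {n} eq =
  *-cancelˡ-≡ m n 2 (trans (cong (m +_) (+-identityʳ m)) (trans eq (cong (n +_) (sym (+-identityʳ n)))))

private
  same-sum-and-product-≤ : ∀ {a b c d} → a ≤ c → a + b ≡ c + d → a * b ≡ c * d → a ≡ c ⊎ a ≡ d
  same-sum-and-product-≤ {a} {b} {_} {d} a≤c sum≡ product≡ with m≤n⇒∃[o]m+o≡n a≤c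
  ... | x , refl with x ≟ℕ 0
  ...   | yes refl = inj₁ (sym (+-identityʳ a))
  ...   | no  x≢0  = inj₂ (*-cancelˡ-≡ a d x {{≢-nonZero x≢0}} xa≡xd)
    where
    open ≡-Reasoning
    b≡x+d : b ≡ x + d
    b≡x+d = +-cancelˡ-≡ a b (x + d) (trans sum≡ (+-assoc a x d))
    xa≡xd : x * a ≡ x * d
    xa≡xd = +-cancelʳ-≡ (a * d) (x * a) (x * d) (begin
      x * a + a * d  ≡⟨ expand-left a x d ⟩
      a * (x + d)    ≡⟨ cong (a *_) b≡x+d ⟨
      a * b          ≡⟨ product≡ ⟩
      (a + x) * d    ≡⟨ expand-right a x d ⟩
      x * d + a * d  ∎)
      where
      expand-left : ∀ a x d → x * a + a * d ≡ a * (x + d)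
      expand-left = solve-∀
      expand-right : ∀ a x d → (a + x) * d ≡ x * d + a * d
      expand-right = solve-∀

-- {a, b} and {c, d} are both the roots of X² - (a + b) X + a b.
same-sum-and-product : ∀ {a b c d} → a + b ≡ c + d → a * b ≡ c * d → a ≡ c ⊎ a ≡ d
same-sum-and-product {a} {b} {c} {d} sum≡ product≡ with ≤-total a c
... | inj₁ a≤c = same-sum-and-product-≤ a≤c sum≡ product≡
... | inj₂ c≤a with same-sum-and-product-≤ c≤a (sym sum≡) (sym product≡)
...   | inj₁ c≡a = inj₁ (sym c≡a)
...   | inj₂ c≡b = inj₂ (+-cancelʳ-≡ b a d (trans sum≡ (trans (cong (_+ d) c≡b) (+-comm b d))))

∑-linear : ∀ {m} x y (f g : Fin m → ℕ) → ∑[ γ < m ] (x * f γ + y * g γ) ≡ x * sum f + y * sum g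
∑-linear x y f g =
  trans (∑-distrib-+ (λ γ → x * f γ) (λ γ → y * g γ)) (sym (cong₂ _+_ (*-distribˡ-sum x f) (*-distribˡ-sum y g)))

∑-expand : ∀ {m} (a b a' b' : Fin m → ℕ) x → sum b ≡ sum a → sum b' ≡ sum a' →
  ∑[ γ < m ] ((a x + b γ) * (a' γ + b' x) + (a γ + b x) * (a' x + b' γ)) ≡
  m * (a x * b' x + b x * a' x) + ((a x + b x) * sum a' + (a' x + b' x) * sum a) +
  ∑[ γ < m ] (b γ * a' γ + a γ * b' γ)
∑-expand {m} a b a' b' x ∑b≡∑a ∑b'≡∑a' = begin
  ∑[ γ < m ] ((a x + b γ) * (a' γ + b' x) + (a γ + b x) * (a' x + b' γ))
    ≡⟨ sum-cong-≗ (λ γ → regroup (a x) (b x) (a' x) (b' x) (a γ) (b γ) (a' γ) (b' γ)) ⟩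
  ∑[ γ < m ] (μ + linear γ + R γ)
    ≡⟨ ∑-distrib-+ (λ γ → μ + linear γ) R ⟩
  ∑[ γ < m ] (μ + linear γ) + sum R
    ≡⟨ cong (_+ sum R) (∑-distrib-+ (λ _ → μ) linear) ⟩
  ∑[ _ < m ] μ + sum linear + sum R
    ≡⟨ cong₂ (λ t u → t + u + sum R) (∑-const m μ) ∑-linear-part ⟩
  m * μ + ((a x * sum a' + b x * sum b') + (a' x * sum a + b' x * sum b)) + sum R
    ≡⟨ cong (λ t → m * μ + t + sum R) (cong₂ _+_ (cong (λ s → a x * sum a' + b x * s) ∑b'≡∑a')
                                                  (cong (λ s → a' x * sum a + b' x * s) ∑b≡∑a)) ⟩
  m * μ + ((a x * sum a' + b x * sum a') + (a' x * sum a + b' x * sum a)) + sum R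
    ≡⟨ cong (λ t → m * μ + t + sum R) (factor (a x) (b x) (a' x) (b' x) (sum a') (sum a)) ⟩
  m * μ + ((a x + b x) * sum a' + (a' x + b' x) * sum a) + sum R ∎
  where
  open ≡-Reasoning
  μ : ℕ
  μ = a x * b' x + b x * a' x
  linear R : Fin m → ℕ
  linear γ = (a x * a' γ + b x * b' γ) + (a' x * a γ + b' x * b γ)
  R γ = b γ * a' γ + a γ * b' γ
  ∑-linear-part : sum linear ≡ (a x * sum a' + b x * sum b') + (a' x * sum a + b' x * sum b)
  ∑-linear-part = trans (∑-distrib-+ (λ γ → a x * a' γ + b x * b' γ) (λ γ → a' x * a γ + b' x * b γ))
                        (cong₂ _+_ (∑-linear (a x) (b x) a' b') (∑-linear (a' x) (b' x) a b))
  regroup : ∀ ax bx a'x b'x aγ bγ a'γ b'γ →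
    (ax + bγ) * (a'γ + b'x) + (aγ + bx) * (a'x + b'γ) ≡
    (ax * b'x + bx * a'x) + ((ax * a'γ + bx * b'γ) + (a'x * aγ + b'x * bγ)) + (bγ * a'γ + aγ * b'γ)
  regroup = solve-∀
  factor : ∀ ax bx a'x b'x s' s →
    (ax * s' + bx * s') + (a'x * s + b'x * s) ≡ (ax + bx) * s' + (a'x + b'x) * s
  factor = solve-∀

xor-cancelʳ : ∀ x y z → x xor z ≡ y xor z → x ≡ y
xor-cancelʳ x y z eq = trans (sym (xor-xor x)) (trans (cong (_xor z) eq) (xor-xor y))
  where
  xor-xor : ∀ a → (a xor z) xor z ≡ a
  xor-xor a = trans (xor-assoc a z z) (trans (cong (a xor_) (xor-same z)) (xor-identityʳ a))

xor-cancelˡ : ∀ x y z → x xor y ≡ x xor z → y ≡ z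
xor-cancelˡ x y z eq = xor-cancelʳ y z x (trans (xor-comm y x) (trans eq (xor-comm x z)))

𝟙-injective : ∀ {a b} → 𝟙 a ≡ 𝟙 b → a ≡ b
𝟙-injective {true}  {true}  _ = refl
𝟙-injective {false} {false} _ = refl

𝟙-xor : ∀ a b → 𝟙 a * 𝟙 (not b) + 𝟙 (not a) * 𝟙 b ≡ 𝟙 (a xor b)
𝟙-xor true  true  = refl
𝟙-xor true  false = refl
𝟙-xor false true  = refl
𝟙-xor false false = refl

*𝟙≢0⇒true : ∀ m b → m * 𝟙 b ≢ 0 → b ≡ true
*𝟙≢0⇒true m true  _       = refl
*𝟙≢0⇒true m false m*0≢0 = ⊥-elim (m*0≢0 (*-zeroʳ m))

module _ {n k : ℕ} (c : Coloring n k) where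

  valencyᵀ : Fin k → Fin n → ℕ
  valencyᵀ C β = count (λ γ → ⌊ c γ β ≟F C ⌋)

  ¬regular⇒∃¬regularClass : ¬ IsRegular c → ∃ λ C → ¬ RegularClass c C
  ¬regular⇒∃¬regularClass = ¬∀⟶∃¬ k (RegularClass c) λ C → all? λ α → all? λ β → valency c C α ≟ℕ valency c C β

  ∑-weighted-valency : ∀ C (w : Fin n → ℕ) → (∀ α β → c α β ≡ C → w α ≡ w β) →
    ∑[ α < n ] (w α * valency c C α) ≡ ∑[ β < n ] (w β * valencyᵀ C β)
  ∑-weighted-valency C w w-const = begin
    ∑[ α < n ] (w α * valency c C α)
      ≡⟨ sum-cong-≗ (λ α → trans (cong (w α *_) (count≡∑𝟙 (λ γ → ⌊ c α γ ≟F C ⌋)))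
                                 (*-distribˡ-sum (w α) (λ γ → 𝟙 ⌊ c α γ ≟F C ⌋))) ⟩
    ∑[ α < n ] ∑[ γ < n ] (w α * 𝟙 ⌊ c α γ ≟F C ⌋)
      ≡⟨ sum-cong-≗ (λ α → sum-cong-≗ (move-weight α)) ⟩
    ∑[ α < n ] ∑[ γ < n ] (w γ * 𝟙 ⌊ c α γ ≟F C ⌋)
      ≡⟨ ∑-comm (λ α γ → w γ * 𝟙 ⌊ c α γ ≟F C ⌋) ⟩
    ∑[ γ < n ] ∑[ α < n ] (w γ * 𝟙 ⌊ c α γ ≟F C ⌋)
      ≡⟨ sum-cong-≗ (λ γ → sym (trans (cong (w γ *_) (count≡∑𝟙 (λ α → ⌊ c α γ ≟F C ⌋)))
                                      (*-distribˡ-sum (w γ) (λ α → 𝟙 ⌊ c α γ ≟F C ⌋)))) ⟩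
    ∑[ γ < n ] (w γ * valencyᵀ C γ) ∎
    where
    open ≡-Reasoning
    move-weight : ∀ α γ → w α * 𝟙 ⌊ c α γ ≟F C ⌋ ≡ w γ * 𝟙 ⌊ c α γ ≟F C ⌋
    move-weight α γ with c α γ ≟F C
    ... | yes αγ∈C = cong (_* 1) (w-const α γ αγ∈C)
    ... | no  _    = trans (*-zeroʳ (w α)) (sym (*-zeroʳ (w γ)))

  ∑-valency≡∑-valencyᵀ : ∀ C → ∑[ α < n ] valency c C α ≡ ∑[ β < n ] valencyᵀ C β
  ∑-valency≡∑-valencyᵀ C =
    trans (sum-cong-≗ (λ α → sym (+-identityʳ (valency c C α))))
          (trans (∑-weighted-valency C (λ _ → 1) (λ _ _ _ → refl))
                 (sum-cong-≗ (λ β → +-identityʳ (valencyᵀ C β))))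

  record Bipartite (C : Fin k) : Set where
    field
      degree         : ℕ
      degree-nonZero : NonZero degree
      source         : Fin n → Bool
      valency≡       : ∀ α → valency c C α ≡ degree * 𝟙 (source α)
      valencyᵀ≡      : ∀ α → valencyᵀ C α ≡ degree * 𝟙 (not (source α))

    edge-source : ∀ {α β} → c α β ≡ C → source α ≡ true
    edge-source {α} {β} αβ∈C = *𝟙≢0⇒true degree (source α) λ degree*𝟙≡0 →
      count-positive (λ γ → ⌊ c α γ ≟F C ⌋) β (fromWitness αβ∈C) (trans (valency≡ α) degree*𝟙≡0)

    edge-target : ∀ {α β} → c α β ≡ C → source β ≡ false
    edge-target {α} {β} αβ∈C = not-injective (*𝟙≢0⇒true degree (not (source β)) λ degree*𝟙≡0 →
      count-positive (λ γ → ⌊ c γ β ≟F C ⌋) α (fromWitness αβ∈C) (trans (valencyᵀ≡ β) degree*𝟙≡0))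

    valency-source : ∀ {α} → source α ≡ true → valency c C α ≡ degree
    valency-source {α} α-source = trans (valency≡ α) (trans (cong (λ b → degree * 𝟙 b) α-source) (*-identityʳ degree))

    balanced : count (not ∘ source) ≡ count source
    balanced = *-cancelˡ-≡ _ _ degree {{degree-nonZero}} (begin
      degree * count (not ∘ source)            ≡⟨ cong (degree *_) (count≡∑𝟙 (not ∘ source)) ⟩
      degree * ∑[ α < n ] 𝟙 (not (source α))  ≡⟨ *-distribˡ-sum degree (λ α → 𝟙 (not (source α))) ⟩
      ∑[ α < n ] (degree * 𝟙 (not (source α))) ≡⟨ sum-cong-≗ valencyᵀ≡ ⟨
      ∑[ α < n ] valencyᵀ C α                  ≡⟨ ∑-valency≡∑-valencyᵀ C ⟨
      ∑[ α < n ] valency c C α                 ≡⟨ sum-cong-≗ valency≡ ⟩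
      ∑[ α < n ] (degree * 𝟙 (source α))       ≡⟨ *-distribˡ-sum degree (λ α → 𝟙 (source α)) ⟨
      degree * ∑[ α < n ] 𝟙 (source α)         ≡⟨ cong (degree *_) (count≡∑𝟙 source) ⟨
      degree * count source                    ∎)
      where open ≡-Reasoning

  ∑-symmetrised≡∑-inter : ∀ (G : Fin k → Fin k → ℕ) α β →
    ∑[ γ < n ] (G (c α γ) (c γ β) + G (c γ β) (c α γ)) ≡
    ∑[ i < k ] ∑[ j < k ] (G i j * (inter c i j α β + inter c j i α β))
  ∑-symmetrised≡∑-inter G α β = begin
    ∑[ γ < n ] (G (c α γ) (c γ β) + G (c γ β) (c α γ))
      ≡⟨ ∑-distrib-+ (λ γ → G (c α γ) (c γ β)) (λ γ → G (c γ β) (c α γ)) ⟩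
    ∑[ γ < n ] G (c α γ) (c γ β) + ∑[ γ < n ] G (c γ β) (c α γ)
      ≡⟨ cong₂ _+_ (∑-fibres (c α) (λ γ → c γ β) G) (∑-fibres (c α) (λ γ → c γ β) (λ i j → G j i)) ⟩
    ∑[ i < k ] ∑[ j < k ] (G i j * I i j) + ∑[ i < k ] ∑[ j < k ] (G j i * I i j)
      ≡⟨ cong (∑[ i < k ] ∑[ j < k ] (G i j * I i j) +_) (∑-comm (λ i j → G j i * I i j)) ⟩
    ∑[ i < k ] ∑[ j < k ] (G i j * I i j) + ∑[ i < k ] ∑[ j < k ] (G i j * I j i)
      ≡⟨ ∑-distrib-+ (λ i → ∑[ j < k ] (G i j * I i j)) (λ i → ∑[ j < k ] (G i j * I j i)) ⟨
    ∑[ i < k ] (∑[ j < k ] (G i j * I i j) + ∑[ j < k ] (G i j * I j i))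
      ≡⟨ sum-cong-≗ (λ i → ∑-distrib-+ (λ j → G i j * I i j) (λ j → G i j * I j i)) ⟨
    ∑[ i < k ] ∑[ j < k ] (G i j * I i j + G i j * I j i)
      ≡⟨ sum-cong-≗ (λ i → sum-cong-≗ (λ j → *-distribˡ-+ (G i j) (I i j) (I j i))) ⟨
    ∑[ i < k ] ∑[ j < k ] (G i j * (I i j + I j i)) ∎
    where
    open ≡-Reasoning
    I : Fin k → Fin k → ℕ
    I i j = inter c i j α β

module JordanConfiguration {n k : ℕ} {c : Coloring n k} (isJordan : IsJordan c) where

  private
    d dᵀ : Fin k → Fin n → ℕ
    d = valency c
    dᵀ = valencyᵀ c
    surjective : Surjective c
    surjective = proj₁ (proj₁ isJordan)

  jordan-∑ : ∀ (G : Fin k → Fin k → ℕ) {α β α' β'} → c α β ≡ c α' β' →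
    ∑[ γ < n ] (G (c α γ) (c γ β) + G (c γ β) (c α γ)) ≡
    ∑[ γ < n ] (G (c α' γ) (c γ β') + G (c γ β') (c α' γ))
  jordan-∑ G {α} {β} {α'} {β'} same-colour =
    trans (∑-symmetrised≡∑-inter c G α β)
          (trans (sum-cong-≗ λ i → sum-cong-≗ λ j → cong (G i j *_) (proj₂ isJordan i j α β α' β' same-colour))
                 (sym (∑-symmetrised≡∑-inter c G α' β')))

  valency+valencyᵀ-determined : ∀ C {α β α' β'} → c α β ≡ c α' β' → d C α + dᵀ C β ≡ d C α' + dᵀ C β'
  valency+valencyᵀ-determined C {α} {β} {α'} {β'} same-colour =
    trans (sym (∑-𝟙 α β)) (trans (jordan-∑ (λ i _ → 𝟙 ⌊ i ≟F C ⌋) same-colour) (∑-𝟙 α' β'))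
    where
    ∑-𝟙 : ∀ α β → ∑[ γ < n ] (𝟙 ⌊ c α γ ≟F C ⌋ + 𝟙 ⌊ c γ β ≟F C ⌋) ≡ d C α + dᵀ C β
    ∑-𝟙 α β = trans (∑-distrib-+ (λ γ → 𝟙 ⌊ c α γ ≟F C ⌋) (λ γ → 𝟙 ⌊ c γ β ≟F C ⌋))
                    (sym (cong₂ _+_ (count≡∑𝟙 (λ γ → ⌊ c α γ ≟F C ⌋)) (count≡∑𝟙 (λ γ → ⌊ c γ β ≟F C ⌋))))

  valency+valencyᵀ-factorises : ∀ C → Σ (Fin k → ℕ) λ p → ∀ α β → d C α + dᵀ C β ≡ p (c α β)
  valency+valencyᵀ-factorises C = p , λ α β → valency+valencyᵀ-determined C (sym (representative-colour (c α β)))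
    where
    representative-colour : ∀ i → c (proj₁ (surjective i)) (proj₁ (proj₂ (surjective i))) ≡ i
    representative-colour i = proj₂ (proj₂ (surjective i))
    p : Fin k → ℕ
    p i = d C (proj₁ (surjective i)) + dᵀ C (proj₁ (proj₂ (surjective i)))

  module Homogeneous (oneDiagonal : DiagonalOneClass c) where

    valency+valencyᵀ-const : ∀ C α β → d C α + dᵀ C α ≡ d C β + dᵀ C β
    valency+valencyᵀ-const C α β = valency+valencyᵀ-determined C (oneDiagonal α β)

    mixedProduct : Fin k → Fin k → Fin n → ℕ
    mixedProduct C C' α = d C α * dᵀ C' α + dᵀ C α * d C' α

    -- Jordan's identity at (α, α) and (β, β) for the weights p_C(i) p_C'(j); after expansion the
    -- n-fold mixed product is the only term that may depend on the point.
    mixedProduct-const : ∀ C C' α β → mixedProduct C C' α ≡ mixedProduct C C' β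
    mixedProduct-const C C' α β =
      *-cancelˡ-≡ _ _ n {{nonZeroIndex α}} (+-cancelʳ-≡ _ _ _ (+-cancelʳ-≡ _ _ _ (begin
        n * mixedProduct C C' α + L α + R  ≡⟨ expand α ⟨
        Ψ α                                ≡⟨ Ψ≡∑p α ⟩
        ∑[ γ < n ] (P (c α γ) (c γ α) + P (c γ α) (c α γ))
                                           ≡⟨ jordan-∑ P (oneDiagonal α β) ⟩
        ∑[ γ < n ] (P (c β γ) (c γ β) + P (c γ β) (c β γ))
                                           ≡⟨ Ψ≡∑p β ⟨
        Ψ β                                ≡⟨ expand β ⟩
        n * mixedProduct C C' β + L β + R  ≡⟨ cong (λ t → n * mixedProduct C C' β + t + R) (L-const β α) ⟩
        n * mixedProduct C C' β + L α + R  ∎)))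
      where
      open ≡-Reasoning
      p  = proj₁ (valency+valencyᵀ-factorises C)
      p' = proj₁ (valency+valencyᵀ-factorises C')
      P : Fin k → Fin k → ℕ
      P i j = p i * p' j
      Ψ : Fin n → ℕ
      Ψ x = ∑[ γ < n ] ((d C x + dᵀ C γ) * (d C' γ + dᵀ C' x) + (d C γ + dᵀ C x) * (d C' x + dᵀ C' γ))
      Ψ≡∑p : ∀ x → Ψ x ≡ ∑[ γ < n ] (P (c x γ) (c γ x) + P (c γ x) (c x γ))
      Ψ≡∑p x = sum-cong-≗ λ γ → cong₂ _+_ (cong₂ _*_ (p≡ x γ) (p'≡ γ x)) (cong₂ _*_ (p≡ γ x) (p'≡ x γ))
        where
        p≡  = proj₂ (valency+valencyᵀ-factorises C)
        p'≡ = proj₂ (valency+valencyᵀ-factorises C')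
      L : Fin n → ℕ
      L x = (d C x + dᵀ C x) * sum (d C') + (d C' x + dᵀ C' x) * sum (d C)
      L-const : ∀ x y → L x ≡ L y
      L-const x y = cong₂ _+_ (cong (_* sum (d C')) (valency+valencyᵀ-const C x y))
                              (cong (_* sum (d C)) (valency+valencyᵀ-const C' x y))
      R : ℕ
      R = ∑[ γ < n ] (dᵀ C γ * d C' γ + d C γ * dᵀ C' γ)
      expand : ∀ x → Ψ x ≡ n * mixedProduct C C' x + L x + R
      expand x = ∑-expand (d C) (dᵀ C) (d C') (dᵀ C') x
        (sym (∑-valency≡∑-valencyᵀ c C)) (sym (∑-valency≡∑-valencyᵀ c C'))

    valency*valencyᵀ-const : ∀ C α β → d C α * dᵀ C α ≡ d C β * dᵀ C β
    valency*valencyᵀ-const C α β = m+m≡n+n⇒m≡n (begin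
      d C α * dᵀ C α + d C α * dᵀ C α  ≡⟨ cong (d C α * dᵀ C α +_) (*-comm (d C α) (dᵀ C α)) ⟩
      mixedProduct C C α             ≡⟨ mixedProduct-const C C α β ⟩
      mixedProduct C C β             ≡⟨ cong (d C β * dᵀ C β +_) (*-comm (dᵀ C β) (d C β)) ⟩
      d C β * dᵀ C β + d C β * dᵀ C β  ∎)
      where open ≡-Reasoning

    -- The C-edges leaving the level set {α | d C α ≡ d C a} are the ones entering it, which
    -- forces d C a ≡ dᵀ C a.
    level-preserving⇒regular : ∀ C → (∀ α β → c α β ≡ C → d C α ≡ d C β) → RegularClass c C
    level-preserving⇒regular C preserves α β = m+m≡n+n⇒m≡n (begin
      d C α + d C α  ≡⟨ cong (d C α +_) (d≡dᵀ α) ⟩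
      d C α + dᵀ C α  ≡⟨ valency+valencyᵀ-const C α β ⟩
      d C β + dᵀ C β  ≡⟨ cong (d C β +_) (d≡dᵀ β) ⟨
      d C β + d C β  ∎)
      where
      open ≡-Reasoning
      d≡dᵀ : ∀ a → d C a ≡ dᵀ C a
      d≡dᵀ a = *-cancelʳ-≡ _ _ (count level) {{≢-nonZero (count-positive level a (fromWitness refl))}} (begin
        d C a * count level                   ≡⟨ cong (d C a *_) (count≡∑𝟙 level) ⟩
        d C a * ∑[ α < n ] 𝟙 (level α)        ≡⟨ *-distribˡ-sum (d C a) (𝟙 ∘ level) ⟩
        ∑[ α < n ] (d C a * 𝟙 (level α))      ≡⟨ sum-cong-≗ (on-level (d C) λ _ eq → eq) ⟩
        ∑[ α < n ] (𝟙 (level α) * d C α)      ≡⟨ ∑-weighted-valency c C (𝟙 ∘ level) level-const ⟩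
        ∑[ α < n ] (𝟙 (level α) * dᵀ C α)      ≡⟨ sum-cong-≗ (on-level (dᵀ C) dᵀ-on-level) ⟨
        ∑[ α < n ] (dᵀ C a * 𝟙 (level α))      ≡⟨ *-distribˡ-sum (dᵀ C a) (𝟙 ∘ level) ⟨
        dᵀ C a * ∑[ α < n ] 𝟙 (level α)        ≡⟨ cong (dᵀ C a *_) (count≡∑𝟙 level) ⟨
        dᵀ C a * count level                   ∎)
        where
        level : Fin n → Bool
        level α = ⌊ d C α ≟ℕ d C a ⌋
        level-const : ∀ α β → c α β ≡ C → 𝟙 (level α) ≡ 𝟙 (level β)
        level-const α β αβ∈C = cong (λ t → 𝟙 ⌊ t ≟ℕ d C a ⌋) (preserves α β αβ∈C)
        dᵀ-on-level : ∀ α → d C α ≡ d C a → dᵀ C α ≡ dᵀ C a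
        dᵀ-on-level α eq = +-cancelˡ-≡ (d C a) _ _ (trans (cong (_+ dᵀ C α) (sym eq)) (valency+valencyᵀ-const C α a))
        on-level : ∀ (f : Fin n → ℕ) → (∀ α → d C α ≡ d C a → f α ≡ f a) → ∀ α → f a * 𝟙 (level α) ≡ 𝟙 (level α) * f α
        on-level f f-on-level α with d C α ≟ℕ d C a
        ... | yes eq = trans (*-identityʳ (f a)) (trans (sym (f-on-level α eq)) (sym (*-identityˡ (f α))))
        ... | no  _  = *-zeroʳ (f a)

    module NonRegularClass (C : Fin k) (¬regular : ¬ RegularClass c C) where

      valency-changes-along-edge : ∀ {α β} → c α β ≡ C → d C α ≢ d C β
      valency-changes-along-edge {α} {β} αβ∈C dα≡dβ =
        ¬regular (level-preserving⇒regular C λ α' β' α'β'∈C → +-cancelʳ-≡ (dᵀ C β') _ _ (begin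
          d C α' + dᵀ C β'  ≡⟨ valency+valencyᵀ-determined C (trans α'β'∈C (sym αβ∈C)) ⟩
          d C α + dᵀ C β    ≡⟨ cong (_+ dᵀ C β) dα≡dβ ⟩
          d C β + dᵀ C β    ≡⟨ valency+valencyᵀ-const C β β' ⟩
          d C β' + dᵀ C β'  ∎))
        where open ≡-Reasoning

      edge-swaps-valencies : ∀ {α β} → c α β ≡ C → d C α ≡ dᵀ C β × dᵀ C α ≡ d C β
      edge-swaps-valencies {α} {β} αβ∈C
        with same-sum-and-product (valency+valencyᵀ-const C α β) (valency*valencyᵀ-const C α β)
      ... | inj₁ dα≡dβ = ⊥-elim (valency-changes-along-edge αβ∈C dα≡dβ)
      ... | inj₂ dα≡dᵀβ = dα≡dᵀβ , +-cancelˡ-≡ (d C α) _ _ (begin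
        d C α + dᵀ C α  ≡⟨ valency+valencyᵀ-const C α β ⟩
        d C β + dᵀ C β  ≡⟨ cong (d C β +_) dα≡dᵀβ ⟨
        d C β + d C α  ≡⟨ +-comm (d C β) (d C α) ⟩
        d C α + d C β  ∎)
        where open ≡-Reasoning

      out-neighbour : ∀ {α} → d C α ≢ 0 → ∃ λ γ → c α γ ≡ C
      out-neighbour dα≢0 = let γ , αγ∈C = count-witness _ dα≢0 in γ , toWitness αγ∈C

      edge-target-valency≡0 : ∀ {α β} → c α β ≡ C → d C β ≡ 0
      edge-target-valency≡0 {α} {β} αβ∈C with d C β ≟ℕ 0
      ... | yes dβ≡0 = dβ≡0
      ... | no  dβ≢0 = ⊥-elim (valency-changes-along-edge αβ∈C (m+m≡n+n⇒m≡n (begin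
        d C α + d C α  ≡⟨ cong (d C α +_) (proj₁ (edge-swaps-valencies αβ∈C)) ⟩
        d C α + dᵀ C β  ≡⟨ valency+valencyᵀ-determined C (trans αβ∈C (sym βγ∈C)) ⟩
        d C β + dᵀ C γ  ≡⟨ cong (d C β +_) (proj₁ (edge-swaps-valencies βγ∈C)) ⟨
        d C β + d C β  ∎)))
        where
        open ≡-Reasoning
        γ = proj₁ (out-neighbour dβ≢0)
        βγ∈C = proj₂ (out-neighbour dβ≢0)

      valency≢0⇒valencyᵀ≡0 : ∀ {α} → d C α ≢ 0 → dᵀ C α ≡ 0
      valency≢0⇒valencyᵀ≡0 dα≢0 =
        let γ , αγ∈C = out-neighbour dα≢0 in trans (proj₂ (edge-swaps-valencies αγ∈C)) (edge-target-valency≡0 αγ∈C)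

    nonRegular⇒bipartite : ∀ C → ¬ RegularClass c C → Bipartite c C
    nonRegular⇒bipartite C ¬regular = record
      { degree         = K
      ; degree-nonZero = ≢-nonZero K≢0
      ; source         = λ α → not ⌊ d C α ≟ℕ 0 ⌋
      ; valency≡       = valency≡
      ; valencyᵀ≡      = valencyᵀ≡
      }
      where
      open NonRegularClass C ¬regular
      α₀ β₀ : Fin n
      α₀ = proj₁ (surjective C)
      β₀ = proj₁ (proj₂ (surjective C))
      K : ℕ
      K = d C α₀ + dᵀ C α₀
      K≢0 : K ≢ 0
      K≢0 K≡0 = count-positive (λ γ → ⌊ c α₀ γ ≟F C ⌋) β₀ (fromWitness (proj₂ (proj₂ (surjective C))))
                               (m+n≡0⇒m≡0 (d C α₀) K≡0)
      valency≡ : ∀ α → d C α ≡ K * 𝟙 (not ⌊ d C α ≟ℕ 0 ⌋)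
      valency≡ α with d C α ≟ℕ 0
      ... | yes dα≡0 = trans dα≡0 (sym (*-zeroʳ K))
      ... | no  dα≢0 = trans (sym (+-identityʳ (d C α))) (trans (cong (d C α +_) (sym (valency≢0⇒valencyᵀ≡0 dα≢0)))
                              (trans (valency+valencyᵀ-const C α α₀) (sym (*-identityʳ K))))
      valencyᵀ≡ : ∀ α → dᵀ C α ≡ K * 𝟙 (not (not ⌊ d C α ≟ℕ 0 ⌋))
      valencyᵀ≡ α with d C α ≟ℕ 0
      ... | yes dα≡0 = trans (cong (_+ dᵀ C α) (sym dα≡0)) (trans (valency+valencyᵀ-const C α α₀) (sym (*-identityʳ K)))
      ... | no  dα≢0 = trans (valency≢0⇒valencyᵀ≡0 dα≢0) (sym (*-zeroʳ K))

    bipartite-xor-const : ∀ {C C'} (B : Bipartite c C) (B' : Bipartite c C') α β →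
      Bipartite.source B α xor Bipartite.source B' α ≡ Bipartite.source B β xor Bipartite.source B' β
    bipartite-xor-const {C} {C'} B B' α β =
      𝟙-injective (*-cancelˡ-≡ _ _ (K * K') {{m*n≢0 K K' {{degree-nonZero B}} {{degree-nonZero B'}}}}
        (trans (sym (mixedProduct≡ α)) (trans (mixedProduct-const C C' α β) (mixedProduct≡ β))))
      where
      open Bipartite
      K K' : ℕ
      K  = degree B
      K' = degree B'
      mixedProduct≡ : ∀ x → mixedProduct C C' x ≡ K * K' * 𝟙 (source B x xor source B' x)
      mixedProduct≡ x = begin
        d C x * dᵀ C' x + dᵀ C x * d C' x
          ≡⟨ cong₂ _+_ (cong₂ _*_ (valency≡ B x) (valencyᵀ≡ B' x)) (cong₂ _*_ (valencyᵀ≡ B x) (valency≡ B' x)) ⟩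
        K * 𝟙 s * (K' * 𝟙 (not s')) + K * 𝟙 (not s) * (K' * 𝟙 s')
          ≡⟨ regroup K K' (𝟙 s) (𝟙 (not s')) (𝟙 (not s)) (𝟙 s') ⟩
        K * K' * (𝟙 s * 𝟙 (not s') + 𝟙 (not s) * 𝟙 s')
          ≡⟨ cong (K * K' *_) (𝟙-xor s s') ⟩
        K * K' * 𝟙 (s xor s') ∎
        where
        open ≡-Reasoning
        s  = source B x
        s' = source B' x
        regroup : ∀ K K' a b a' b' → K * a * (K' * b) + K * a' * (K' * b') ≡ K * K' * (a * b + a' * b')
        regroup = solve-∀

    bipartite-class-side : ∀ {C₀ C} (B₀ : Bipartite c C₀) (B : Bipartite c C) → Σ Bool λ s →
      (∀ α β → c α β ≡ C → (Bipartite.source B₀ α ≡ s) × (Bipartite.source B₀ β ≡ not s)) ×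
      (∀ α α' → Bipartite.source B₀ α ≡ s → Bipartite.source B₀ α' ≡ s → valency c C α ≡ valency c C α')
    bipartite-class-side {C₀} {C} B₀ B = source₀ α₁ , edges , valencies
      where
      open Bipartite B
      source₀ = Bipartite.source B₀
      α₁ : Fin n
      α₁ = proj₁ (surjective C)
      α₁-source : source α₁ ≡ true
      α₁-source = edge-source (proj₂ (proj₂ (surjective C)))
      same-side : ∀ α β → source α ≡ source β → source₀ α ≡ source₀ β
      same-side α β eq = xor-cancelʳ _ _ (source β) (trans (cong (source₀ α xor_) (sym eq)) (bipartite-xor-const B₀ B α β))
      same-side₀ : ∀ α β → source₀ α ≡ source₀ β → source α ≡ source β
      same-side₀ α β eq = xor-cancelˡ (source₀ β) _ _ (trans (cong (_xor source α) (sym eq)) (bipartite-xor-const B₀ B α β))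
      edges : ∀ α β → c α β ≡ C → (source₀ α ≡ source₀ α₁) × (source₀ β ≡ not (source₀ α₁))
      edges α β αβ∈C =
        same-side α α₁ (trans (edge-source αβ∈C) (sym α₁-source)) ,
        ¬-not λ eq → not-¬ (edge-target αβ∈C) (trans (same-side₀ β α₁ eq) α₁-source)
      valencies : ∀ α α' → source₀ α ≡ source₀ α₁ → source₀ α' ≡ source₀ α₁ → valency c C α ≡ valency c C α'
      valencies α α' eq eq' = trans (valency-source (on-source-side eq)) (sym (valency-source (on-source-side eq')))
        where
        on-source-side : ∀ {x} → source₀ x ≡ source₀ α₁ → source x ≡ true
        on-source-side {x} eq = trans (same-side₀ x α₁ eq) α₁-source

proposition2p2 : (n k : ℕ) (c : Coloring n k) → IsJordan c → DiagonalOneClass c →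
    ¬ IsRegular c →
    Σ (Fin n → Bool) λ part →
      (count (λ ω → ⌊ part ω ≟ false ⌋) ≡ count (λ ω → ⌊ part ω ≟ true ⌋)) ×
      ((i : Fin k) → ¬ RegularClass c i →
        Σ Bool λ s →
          ((α β : Fin n) → c α β ≡ i → (part α ≡ s) × (part β ≡ not s)) ×
          ((α α' : Fin n) → part α ≡ s → part α' ≡ s → valency c i α ≡ valency c i α'))
proposition2p2 n k c isJordan oneDiagonal ¬regular =
  part , equal-halves , λ i ¬regularᵢ → bipartite-class-side B₀ (nonRegular⇒bipartite i ¬regularᵢ)
  where
  open JordanConfiguration isJordan
  open Homogeneous oneDiagonal
  B₀ : Bipartite c (proj₁ (¬regular⇒∃¬regularClass c ¬regular))
  B₀ = nonRegular⇒bipartite _ (proj₂ (¬regular⇒∃¬regularClass c ¬regular))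
  part : Fin n → Bool
  part = Bipartite.source B₀
  equal-halves : count (λ ω → ⌊ part ω ≟ false ⌋) ≡ count (λ ω → ⌊ part ω ≟ true ⌋)
  equal-halves = trans (count-cong (≟false ∘ part)) (trans (Bipartite.balanced B₀) (count-cong (sym ∘ ≟true ∘ part)))
    where
    ≟false : ∀ b → ⌊ b ≟ false ⌋ ≡ not b
    ≟false true  = refl
    ≟false false = refl
    ≟true : ∀ b → ⌊ b ≟ true ⌋ ≡ b
    ≟true true  = refl
    ≟true false = refl
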